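{- Let $n = 2^m$ with $m \geq 2$. Let $G = \{A \subseteq \{1,\dots,n-1\} : |A| \text{ even}\}$ (a group under $\Delta$), let $H$ be the subgroup generated by $\{\{j, 2^{i-1}+j\} : j = 1, \dots, 2^{i-1}-1,\ i = 2, \dots, m\}$, and let $H_1 = H$ and $H_i = \{1,\dots,2i-2\}\,\Delta\, H$ for $i = 2, \dots, n/2$. Let $S = (1, 2, \dots, n, 1, 2, \dots, n)$. Then for each $i \in \{1, \dots, n/2\}$, the members of $\{C(A, S) : A \in H_i\}$ are pairwise vertex-disjoint cycles of length $2n$ in $Q_n$, and their union is a spanning $2$-regular subgraph of $Q_n$.
   Context: Identify the vertex set of the hypercube $Q_n$ with the power set of $\{1,\dots,n\}$; $U, V$ are adjacent iff $|U \Delta V| = 1$, where $\Delta$ is symmetric difference. For $U \subseteq \{1,\dots,n\}$ and a sequence $S = (s_1, \dots, s_k)$ of elements of $\{1,\dots,n\}$, $C(U,S)$ denotes the closed walk $U_1 - U_2 - \cdots - U_k - U_1$ with $U_1 = U$ and $U_{j+1} = U_j \Delta \{s_j\}$ for $j = 1, \dots, k-1$ (where $U_k \Delta\{s_k\} = U_1$). -}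

module Defs where

open import Data.Bool using (Bool; true; false; _xor_; _∨_)
open import Data.Nat using (ℕ; zero; suc; _+_; _*_; _∸_; _^_; _≤_; _≡ᵇ_; _≤ᵇ_)
open import Data.Fin using (Fin; toℕ)
open import Data.Fin.Subset using (Subset; ⁅_⁆; ⊥)
open import Data.Vec using (tabulate; zipWith)
open import Data.List using (List; []; _∷_; _++_; length; allFin)
open import Data.List.Membership.Propositional using (_∈_)
open import Data.List.Relation.Unary.Unique.Propositional using (Unique)
open import Data.Product using (Σ; ∃; ∃-syntax; _×_; _,_)
open import Data.Sum using (_⊎_)
open import Relation.Binary.PropositionalEquality using (_≡_; _≢_)

-- Vertices of Q_n: subsets of {1,…,n}, as Subset n = Vec Bool n.
-- Convention: index x : Fin n represents the element toℕ x + 1 of {1,…,n}.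

_Δ_ : ∀ {n} → Subset n → Subset n → Subset n
_Δ_ = zipWith _xor_

fromPred : ∀ {n} → (ℕ → Bool) → Subset n
fromPred P = tabulate (λ x → P (suc (toℕ x)))

walkVertices : ∀ {n} → Subset n → List (Fin n) → List (Subset n)
walkVertices U [] = []
walkVertices U (s ∷ ss) = U ∷ walkVertices (U Δ ⁅ s ⁆) ss

walkEnd : ∀ {n} → Subset n → List (Fin n) → Subset n
walkEnd U [] = U
walkEnd U (s ∷ ss) = walkEnd (U Δ ⁅ s ⁆) ss

walkEdges : ∀ {n} → Subset n → List (Fin n) → List (Subset n × Subset n)
walkEdges U [] = []
walkEdges U (s ∷ ss) = (U , U Δ ⁅ s ⁆) ∷ walkEdges (U Δ ⁅ s ⁆) ss

IsWalkEdge : ∀ {n} → Subset n → List (Fin n) → Subset n → Subset n → Set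
IsWalkEdge U S V W = ((V , W) ∈ walkEdges U S) ⊎ ((W , V) ∈ walkEdges U S)

IsCycleOfLength : ∀ {n} → ℕ → Subset n → List (Fin n) → Set
IsCycleOfLength L U S =
  walkEnd U S ≡ U × length (walkVertices U S) ≡ L × Unique (walkVertices U S)

seqS : (m : ℕ) → List (Fin (2 ^ m))
seqS m = allFin (2 ^ m) ++ allFin (2 ^ m)

gen : (m i j : ℕ) → Subset (2 ^ m)
gen m i j = fromPred (λ k → (k ≡ᵇ j) ∨ (k ≡ᵇ 2 ^ (i ∸ 1) + j))

data InH (m : ℕ) : Subset (2 ^ m) → Set where
  H-empty : InH m ⊥
  H-step  : ∀ {A} (i j : ℕ) → 2 ≤ i → i ≤ m → 1 ≤ j → j ≤ 2 ^ (i ∸ 1) ∸ 1 →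
            InH m A → InH m (gen m i j Δ A)

upToSet : ∀ {n} → ℕ → Subset n
upToSet k = fromPred (λ x → x ≤ᵇ k)

-- H_i = {1,…,2i-2} Δ H   (for i = 1 this is ∅ Δ H = H)
InHi : (m i : ℕ) → Subset (2 ^ m) → Set
InHi m i A = ∃[ B ] (InH m B × A ≡ upToSet (2 * i ∸ 2) Δ B)

UnionEdge : (m i : ℕ) → Subset (2 ^ m) → Subset (2 ^ m) → Set
UnionEdge m i V W = ∃[ A ] (InHi m i A × IsWalkEdge A (seqS m) V W)

UnionSpanning : (m i : ℕ) → Set
UnionSpanning m i = ∀ V → ∃[ A ] (InHi m i A × V ∈ walkVertices A (seqS m))

UnionTwoRegular : (m i : ℕ) → Set
UnionTwoRegular m i = ∀ V → ∃[ W₁ ] ∃[ W₂ ]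
  (W₁ ≢ W₂ × UnionEdge m i V W₁ × UnionEdge m i V W₂ ×
   (∀ W → UnionEdge m i V W → W ≡ W₁ ⊎ W ≡ W₂))

-- After r steps the walk C(A, S) is at A Δ W_r, where the window W_r = {k : k ≤ r < n + k}
-- collects the elements met an odd number of times among the first r terms of S.  H is cut
-- out by m + 1 parity checks, obtained by repeatedly folding {1,…,2^ℓ} onto its lower half;
-- a fold maps windows to windows, and induction on m shows that W_0, …, W_{2n-1} form a
-- transversal of H.  So (A, r) ↦ A Δ W_r is a bijection from H_i × {0,…,2n-1} onto the
-- vertices of Q_n: injectivity makes each C(A, S) a cycle and the cycles disjoint,
-- surjectivity makes them spanning, and since 2n > 2 the vertex A Δ W_r has exactly the
-- two neighbours A Δ W_{r±1} (indices mod 2n).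

module Submission where

open import Defs
open import Data.Nat using (ℕ; _≤_; _*_; _^_; _/_)
open import Data.Product using (_×_)
open import Data.Empty using (⊥)
open import Data.List.Membership.Propositional using (_∈_)
open import Relation.Binary.PropositionalEquality using (_≢_)

open import Algebra.Bundles using (CommutativeRing)
open import Algebra.Definitions using (Interchangable)
import Algebra.Properties.CommutativeSemigroup as CommutativeSemigroupProperties
open import Data.Bool using (Bool; true; false; _xor_; _∨_)
open import Data.Bool.Properties
  using ( T-≡; ∨-identityʳ; ∨-zeroʳ; xor-annihilates-not; xor-assoc; xor-comm; xor-same
        ; xor-identityˡ; xor-identityʳ; xor-∧-commutativeRing)
open import Data.Nat using (zero; suc; _+_; _∸_; _<_; _≡ᵇ_; _≤ᵇ_; z≤n; s≤s; _≤?_; _<?_)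
open import Data.Nat.Properties
open import Data.Fin using (Fin; toℕ) renaming (zero to fzero; suc to fsuc)
open import Data.Fin.Subset using (Subset; ⁅_⁆) renaming (⊥ to ∅)
open import Data.Vec using ([]; _∷_)
open import Data.List using (List; []; _∷_; _++_; length; take; map; tabulate; allFin; applyUpTo)
open import Data.List.Properties
  using (length-++; length-tabulate; length-applyUpTo; take-map; take-all; map-tabulate)
open import Data.List.Membership.Propositional.Properties using (∈-applyUpTo⁺; ∈-applyUpTo⁻)
open import Data.List.Relation.Unary.Unique.Propositional using (Unique)
open import Data.List.Relation.Unary.Unique.Propositional.Properties using (applyUpTo⁺₁)
open import Data.Vec.Relation.Binary.Pointwise.Inductive
  using (Pointwise-≡⇒≡; zipWith-assoc; zipWith-comm; zipWith-identityˡ)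
open import Data.Product using (∃-syntax; _,_; proj₁; proj₂)
open import Data.Sum using (_⊎_; inj₁; inj₂)
open import Function using (_∘_; Equivalence)
open import Relation.Nullary using (yes; no; contradiction)
open import Relation.Binary.PropositionalEquality
  using (_≡_; refl; sym; trans; cong; cong₂; subst; module ≡-Reasoning)

≤ᵇ-true : ∀ {a b} → a ≤ b → (a ≤ᵇ b) ≡ true
≤ᵇ-true a≤b = Equivalence.to T-≡ (≤⇒≤ᵇ a≤b)

≤ᵇ-false : ∀ {a b} → b < a → (a ≤ᵇ b) ≡ false
≤ᵇ-false {a} {b} b<a with a ≤ᵇ b in eq
... | false = refl
... | true  = contradiction (≤ᵇ⇒≤ a b (Equivalence.from T-≡ eq)) (<⇒≱ b<a)

≡ᵇ-false : ∀ {a b} → a ≢ b → (a ≡ᵇ b) ≡ false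
≡ᵇ-false {a} {b} a≢b with a ≡ᵇ b in eq
... | false = refl
... | true  = contradiction (≡ᵇ⇒≡ a b (Equivalence.from T-≡ eq)) a≢b

≡ᵇ-refl : ∀ a → (a ≡ᵇ a) ≡ true
≡ᵇ-refl a = Equivalence.to T-≡ (≡⇒≡ᵇ a a refl)

suc-≤ᵇ-suc : ∀ a b → (suc a ≤ᵇ suc b) ≡ (a ≤ᵇ b)
suc-≤ᵇ-suc zero    b = refl
suc-≤ᵇ-suc (suc a) b = refl

+-cancelˡ-≤ᵇ : ∀ a b c → (a + b ≤ᵇ a + c) ≡ (b ≤ᵇ c)
+-cancelˡ-≤ᵇ zero    b c = refl
+-cancelˡ-≤ᵇ (suc a) b c = trans (suc-≤ᵇ-suc (a + b) (a + c)) (+-cancelˡ-≤ᵇ a b c)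

+-cancelˡ-≡ᵇ : ∀ a b c → (a + b ≡ᵇ a + c) ≡ (b ≡ᵇ c)
+-cancelˡ-≡ᵇ zero    b c = refl
+-cancelˡ-≡ᵇ (suc a) b c = +-cancelˡ-≡ᵇ a b c

≤ᵇ-∸ : ∀ n k r → 1 ≤ k → (k ≤ᵇ r ∸ n) ≡ (n + k ≤ᵇ r)
≤ᵇ-∸ n k r 1≤k with r <? n
... | yes r<n rewrite m≤n⇒m∸n≡0 (<⇒≤ r<n) | ≤ᵇ-false (<-≤-trans r<n (m≤m+n n k)) =
  ≤ᵇ-false 1≤k
... | no  r≮n =
  trans (sym (+-cancelˡ-≤ᵇ n k (r ∸ n))) (cong (n + k ≤ᵇ_) (m+[n∸m]≡n (≮⇒≥ r≮n)))

xor-interchange : Interchangable _≡_ _xor_ _xor_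
xor-interchange = CommutativeSemigroupProperties.interchange
  (CommutativeRing.+-commutativeSemigroup xor-∧-commutativeRing)

xor≡false⇒≡ : ∀ {a b} → (a xor b) ≡ false → a ≡ b
xor≡false⇒≡ {false} refl = refl
xor≡false⇒≡ {true}  {true} _ = refl

2^-double : ∀ m → 2 ^ suc m ≡ 2 ^ m + 2 ^ m
2^-double m = cong (2 ^ m +_) (+-identityʳ (2 ^ m))

2^>0 : ∀ m → 1 ≤ 2 ^ m
2^>0 m = m^n>0 2 m

lower-half : ∀ m {k} → k ≤ 2 ^ m → k ≤ 2 ^ suc m
lower-half m k≤ = ≤-trans k≤ (subst (2 ^ m ≤_) (sym (2^-double m)) (m≤m+n _ _))

upper-half : ∀ m {k} → k ≤ 2 ^ m → 2 ^ m + k ≤ 2 ^ suc m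
upper-half m {k} k≤ = subst (2 ^ m + k ≤_) (sym (2^-double m)) (+-monoʳ-≤ (2 ^ m) k≤)

-- member U k tests k ∈ U for k ∈ {1,…,n}, and is false for every other k.
member : ∀ {n} → Subset n → ℕ → Bool
member []      _             = false
member (b ∷ U) zero          = false
member (b ∷ U) (suc zero)    = b
member (b ∷ U) (suc (suc k)) = member U (suc k)

AgreeOn : ℕ → (ℕ → Bool) → (ℕ → Bool) → Set
AgreeOn N P Q = ∀ k → 1 ≤ k → k ≤ N → P k ≡ Q k

SupportedIn : ℕ → (ℕ → Bool) → Set
SupportedIn N P = ∀ k → N < k → P k ≡ false

member-supported : ∀ {n} (U : Subset n) → SupportedIn n (member U)
member-supported []      k             _       = refl
member-supported (b ∷ U) (suc (suc k)) (s≤s p) = member-supported U (suc k) p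

member-fromPred : ∀ {n} (P : ℕ → Bool) → AgreeOn n (member {n} (fromPred P)) P
member-fromPred {suc n} P (suc zero)    _ _       = refl
member-fromPred {suc n} P (suc (suc k)) _ (s≤s q) = member-fromPred (P ∘ suc) (suc k) (s≤s z≤n) q

member-Δ : ∀ {n} (U V : Subset n) k → member (U Δ V) k ≡ (member U k xor member V k)
member-Δ []      []      k             = refl
member-Δ (a ∷ U) (b ∷ V) zero          = refl
member-Δ (a ∷ U) (b ∷ V) (suc zero)    = refl
member-Δ (a ∷ U) (b ∷ V) (suc (suc k)) = member-Δ U V (suc k)

member-∅ : ∀ {n} k → member (∅ {n}) k ≡ false
member-∅ {zero}  k             = refl
member-∅ {suc n} zero          = refl
member-∅ {suc n} (suc zero)    = refl
member-∅ {suc n} (suc (suc k)) = member-∅ {n} (suc k)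

member-⁅⁆ : ∀ {n} (s : Fin n) k → member ⁅ s ⁆ k ≡ (k ≡ᵇ suc (toℕ s))
member-⁅⁆ fzero             zero          = refl
member-⁅⁆ fzero             (suc zero)    = refl
member-⁅⁆ {suc n} fzero     (suc (suc k)) = member-∅ {n} (suc k)
member-⁅⁆ (fsuc s)          zero          = refl
member-⁅⁆ (fsuc s)          (suc zero)    = refl
member-⁅⁆ (fsuc s)          (suc (suc k)) = member-⁅⁆ s (suc k)

member-ext : ∀ {n} (U V : Subset n) → AgreeOn n (member U) (member V) → U ≡ V
member-ext []      []      _ = refl
member-ext (a ∷ U) (b ∷ V) h = cong₂ _∷_ (h 1 (s≤s z≤n) (s≤s z≤n))
  (member-ext U V λ { (suc k) _ k≤n → h (suc (suc k)) (s≤s z≤n) (s≤s k≤n) })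

SupportedIn-weaken : ∀ {N N' P} → N ≤ N' → SupportedIn N P → SupportedIn N' P
SupportedIn-weaken N≤N' s k N'<k = s k (≤-<-trans N≤N' N'<k)

SupportedIn-pred : ∀ {N P} → SupportedIn (suc N) P → P (suc N) ≡ false → SupportedIn N P
SupportedIn-pred s top k N<k with m≤n⇒m<n∨m≡n N<k
... | inj₁ N+1<k = s k N+1<k
... | inj₂ refl  = top

SupportedIn-xor-pred : ∀ {N P Q} → SupportedIn (suc N) P → SupportedIn (suc N) Q →
                       P (suc N) ≡ Q (suc N) → SupportedIn N (λ k → P k xor Q k)
SupportedIn-xor-pred {N} {P} {Q} sP sQ top = SupportedIn-pred
  (λ k N+1<k → cong₂ _xor_ (sP k N+1<k) (sQ k N+1<k))
  (trans (cong (_xor Q (suc N)) top) (xor-same (Q (suc N))))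

SupportedIn-member : ∀ {n N P} (U : Subset n) → AgreeOn n (member U) P → SupportedIn N P →
                     SupportedIn N (member U)
SupportedIn-member {n} U agree s k N<k with k ≤? n
... | yes k≤n = trans (agree k (≤-trans (s≤s z≤n) N<k) k≤n) (s k N<k)
... | no  k≰n = member-supported U k (≰⇒> k≰n)

SupportedIn-0 : ∀ {n} (B : Subset n) → SupportedIn 0 (member B) → B ≡ ∅
SupportedIn-0 {n} B s = member-ext B ∅ λ k 1≤k _ → trans (s k 1≤k) (sym (member-∅ {n} k))

module _ {n : ℕ} where

  Δ-assoc : (X Y Z : Subset n) → (X Δ Y) Δ Z ≡ X Δ (Y Δ Z)
  Δ-assoc X Y Z = Pointwise-≡⇒≡ (zipWith-assoc xor-assoc X Y Z)

  Δ-comm : (X Y : Subset n) → X Δ Y ≡ Y Δ X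
  Δ-comm X Y = Pointwise-≡⇒≡ (zipWith-comm xor-comm X Y)

  Δ-identityˡ : (X : Subset n) → ∅ Δ X ≡ X
  Δ-identityˡ X = Pointwise-≡⇒≡ (zipWith-identityˡ xor-identityˡ X)

  Δ-identityʳ : (X : Subset n) → X Δ ∅ ≡ X
  Δ-identityʳ X = trans (Δ-comm X ∅) (Δ-identityˡ X)

  Δ-self : (X : Subset n) → X Δ X ≡ ∅
  Δ-self X = member-ext (X Δ X) ∅ λ k _ _ →
    trans (member-Δ X X k) (trans (xor-same (member X k)) (sym (member-∅ {n} k)))

  Δ-interchange : (X Y Z W : Subset n) → (X Δ Y) Δ (Z Δ W) ≡ (X Δ Z) Δ (Y Δ W)
  Δ-interchange X Y Z W = member-ext _ _ λ k _ _ → begin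
    member ((X Δ Y) Δ (Z Δ W)) k
      ≡⟨ member-Δ² X Y Z W k ⟩
    (member X k xor member Y k) xor (member Z k xor member W k)
      ≡⟨ xor-interchange (member X k) (member Y k) (member Z k) (member W k) ⟩
    (member X k xor member Z k) xor (member Y k xor member W k)
      ≡⟨ member-Δ² X Z Y W k ⟨
    member ((X Δ Z) Δ (Y Δ W)) k ∎
    where
    open ≡-Reasoning
    member-Δ² : ∀ A B C D k → member ((A Δ B) Δ (C Δ D)) k ≡
                  ((member A k xor member B k) xor (member C k xor member D k))
    member-Δ² A B C D k =
      trans (member-Δ (A Δ B) (C Δ D) k) (cong₂ _xor_ (member-Δ A B k) (member-Δ C D k))

  Δ-cancelˡ : (X Y : Subset n) → X Δ (X Δ Y) ≡ Y
  Δ-cancelˡ X Y = begin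
    X Δ (X Δ Y) ≡⟨ Δ-assoc X X Y ⟨
    (X Δ X) Δ Y ≡⟨ cong (_Δ Y) (Δ-self X) ⟩
    ∅ Δ Y       ≡⟨ Δ-identityˡ Y ⟩
    Y           ∎
    where open ≡-Reasoning

  Δ-cancelʳ : (X Y : Subset n) → (X Δ Y) Δ Y ≡ X
  Δ-cancelʳ X Y = trans (Δ-comm (X Δ Y) Y) (trans (cong (Y Δ_) (Δ-comm X Y)) (Δ-cancelˡ Y X))

  Δ≡∅⇒≡ : {X Y : Subset n} → X Δ Y ≡ ∅ → X ≡ Y
  Δ≡∅⇒≡ {X} {Y} e = begin
    X               ≡⟨ Δ-cancelʳ X Y ⟨
    (X Δ Y) Δ Y     ≡⟨ cong (_Δ Y) e ⟩
    ∅ Δ Y           ≡⟨ Δ-identityˡ Y ⟩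
    Y               ∎
    where open ≡-Reasoning

  Δ-transpose : {X Y Z W : Subset n} → X Δ Y ≡ Z Δ W → X Δ Z ≡ Y Δ W
  Δ-transpose {X} {Y} {Z} {W} e = Δ≡∅⇒≡ (begin
    (X Δ Z) Δ (Y Δ W) ≡⟨ Δ-interchange X Y Z W ⟨
    (X Δ Y) Δ (Z Δ W) ≡⟨ cong (_Δ (Z Δ W)) e ⟩
    (Z Δ W) Δ (Z Δ W) ≡⟨ Δ-self (Z Δ W) ⟩
    ∅                 ∎)
    where open ≡-Reasoning

  Δ-cancelʳ-≡ : {X Y Z : Subset n} → X Δ Z ≡ Y Δ Z → X ≡ Y
  Δ-cancelʳ-≡ {Z = Z} e = Δ≡∅⇒≡ (trans (Δ-transpose e) (Δ-self Z))

InH-Δ : ∀ {m B C} → InH m B → InH m C → InH m (B Δ C)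
InH-Δ {m} {C = C} H-empty hC = subst (InH m) (sym (Δ-identityˡ C)) hC
InH-Δ {m} {C = C} (H-step {A} i j 2≤i i≤m 1≤j j≤ hA) hC =
  subst (InH m) (sym (Δ-assoc (gen m i j) A C)) (H-step i j 2≤i i≤m 1≤j j≤ (InH-Δ hA hC))

-- Parity checks for H

fold : ℕ → (ℕ → Bool) → ℕ → Bool
fold m P k = P k xor P (2 ^ m + k)

-- Balanced m P: for every ℓ ≤ m, an even number of the multiples of 2^ℓ in {1,…,2^m}
-- satisfy P.  These m + 1 parity checks cut out exactly H.
Balanced : ℕ → (ℕ → Bool) → Set
Balanced zero    P = P 1 ≡ false
Balanced (suc m) P = P (2 ^ suc m) ≡ false × Balanced m (fold m P)

fold-cong : ∀ m {P Q} → AgreeOn (2 ^ suc m) P Q → AgreeOn (2 ^ m) (fold m P) (fold m Q)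
fold-cong m h k 1≤k k≤ =
  cong₂ _xor_ (h k 1≤k (lower-half m k≤))
              (h (2 ^ m + k) (≤-trans 1≤k (m≤n+m k _)) (upper-half m k≤))

fold-xor : ∀ m P Q k → fold m (λ x → P x xor Q x) k ≡ (fold m P k xor fold m Q k)
fold-xor m P Q k = xor-interchange (P k) (Q k) (P (2 ^ m + k)) (Q (2 ^ m + k))

fold-supported : ∀ m {P} → SupportedIn (2 ^ m) P → AgreeOn (2 ^ m) (fold m P) P
fold-supported m {P} s k 1≤k _ =
  trans (cong (P k xor_) (s (2 ^ m + k) (m<m+n (2 ^ m) 1≤k))) (xor-identityʳ (P k))

Balanced-cong : ∀ m {P Q} → AgreeOn (2 ^ m) P Q → Balanced m P → Balanced m Q
Balanced-cong zero    h b         = trans (sym (h 1 ≤-refl ≤-refl)) b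
Balanced-cong (suc m) h (top , b) =
  trans (sym (h _ (2^>0 (suc m)) ≤-refl)) top , Balanced-cong m (fold-cong m h) b

Balanced-xor : ∀ m {P Q} → Balanced m P → Balanced m Q → Balanced m (λ k → P k xor Q k)
Balanced-xor zero    p q = cong₂ _xor_ p q
Balanced-xor (suc m) {P} {Q} (p , bp) (q , bq) =
  cong₂ _xor_ p q , Balanced-cong m (λ k _ _ → sym (fold-xor m P Q k)) (Balanced-xor m bp bq)

Balanced-false : ∀ m → Balanced m (λ _ → false)
Balanced-false zero    = refl
Balanced-false (suc m) = refl , Balanced-false m

pair : ℕ → ℕ → ℕ → Bool
pair i j k = (k ≡ᵇ j) ∨ (k ≡ᵇ 2 ^ (i ∸ 1) + j)

member-gen-Δ : ∀ m i j (A : Subset (2 ^ m)) →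
               AgreeOn (2 ^ m) (member (gen m i j Δ A)) (λ k → pair i j k xor member A k)
member-gen-Δ m i j A k 1≤k k≤ =
  trans (member-Δ (gen m i j) A k) (cong (_xor member A k) (member-fromPred (pair i j) k 1≤k k≤))

pair-supported : ∀ p j → SupportedIn (2 ^ p + j) (pair (suc p) j)
pair-supported p j k <k
  rewrite ≡ᵇ-false (<⇒≢ (≤-<-trans (m≤n+m j (2 ^ p)) <k) ∘ sym)
        | ≡ᵇ-false (<⇒≢ <k ∘ sym) = refl

pair<2^suc : ∀ p {j} → j < 2 ^ p → 2 ^ p + j < 2 ^ suc p
pair<2^suc p {j} j< = subst (2 ^ p + j <_) (sym (2^-double p)) (+-monoʳ-< (2 ^ p) j<)

-- The two points of the generator {j, 2^p + j} are identified by the fold.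
fold-pair : ∀ p {j} → 1 ≤ j → j < 2 ^ p → AgreeOn (2 ^ p) (fold p (pair (suc p) j)) (λ _ → false)
fold-pair p {j} 1≤j j< k 1≤k k≤
  rewrite ≡ᵇ-false {k} {2 ^ p + j} (<⇒≢ (≤-<-trans k≤ (m<m+n (2 ^ p) 1≤j)))
        | ≡ᵇ-false {2 ^ p + k} {j} (<⇒≢ (<-≤-trans j< (m≤m+n (2 ^ p) k)) ∘ sym)
        | +-cancelˡ-≡ᵇ (2 ^ p) k j
        | ∨-identityʳ (k ≡ᵇ j) = xor-same (k ≡ᵇ j)

Balanced-pair : ∀ m p {j} → 1 ≤ j → j < 2 ^ p → p < m → Balanced m (pair (suc p) j)
Balanced-pair (suc m) p 1≤j j< (s≤s p≤m) =
  pair-supported p _ _ (<-≤-trans (pair<2^suc p j<) (^-monoʳ-≤ 2 (s≤s p≤m))) , folded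
  where
  folded : Balanced m (fold m (pair (suc p) _))
  folded with m≤n⇒m<n∨m≡n p≤m
  ... | inj₂ refl = Balanced-cong p (λ k 1≤k k≤ → sym (fold-pair p 1≤j j< k 1≤k k≤))
                      (Balanced-false p)
  ... | inj₁ p<m  = Balanced-cong m (λ k 1≤k k≤ → sym (fold-supported m supported k 1≤k k≤))
                      (Balanced-pair m p 1≤j j< p<m)
    where
    supported : SupportedIn (2 ^ m) (pair (suc p) _)
    supported = SupportedIn-weaken (<⇒≤ (<-≤-trans (pair<2^suc p j<) (^-monoʳ-≤ 2 p<m)))
                  (pair-supported p _)

InH⇒Balanced : ∀ {m B} → InH m B → Balanced m (member B)
InH⇒Balanced {m} H-empty = Balanced-cong m (λ k _ _ → sym (member-∅ {2 ^ m} k)) (Balanced-false m)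
InH⇒Balanced {m} (H-step {A} (suc (suc p)) j (s≤s (s≤s z≤n)) i≤m 1≤j j≤ hA) =
  Balanced-cong m (λ k 1≤k k≤ → sym (member-gen-Δ m (suc (suc p)) j A k 1≤k k≤))
    (Balanced-xor m (Balanced-pair m (suc p) 1≤j j< i≤m) (InH⇒Balanced hA))
  where
  j< : j < 2 ^ suc p
  j< = m≤pred[n]⇒suc[m]≤n {{m^n≢0 2 (suc p)}} j≤

fold-gen-Δ : ∀ {M} m {j} → suc m ≤ M → 1 ≤ j → j < 2 ^ m → (B : Subset (2 ^ M)) →
             AgreeOn (2 ^ m) (fold m (member (gen M (suc m) j Δ B))) (fold m (member B))
fold-gen-Δ {M} m {j} m<M 1≤j j< B k 1≤k k≤ = begin
  fold m (member (gen M (suc m) j Δ B)) k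
    ≡⟨ fold-cong m (λ x 1≤x x≤ → member-gen-Δ M (suc m) j B x 1≤x (≤-trans x≤ (^-monoʳ-≤ 2 m<M)))
                 k 1≤k k≤ ⟩
  fold m (λ x → pair (suc m) j x xor member B x) k
    ≡⟨ fold-xor m (pair (suc m) j) (member B) k ⟩
  fold m (pair (suc m) j) k xor fold m (member B) k
    ≡⟨ cong (_xor fold m (member B) k) (fold-pair m 1≤j j< k 1≤k k≤) ⟩
  fold m (member B) k ∎
  where open ≡-Reasoning

-- Each element 2^m + c of the upper half is removed by adding the generator {c, 2^m + c},
-- which leaves the fold unchanged.
clear-upper-half : ∀ {M} m → suc m ≤ M →
  (∀ B → SupportedIn (2 ^ m) (member B) → Balanced m (member B) → InH M B) →
  ∀ c → c ≤ 2 ^ m ∸ 1 → (B : Subset (2 ^ M)) →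
  SupportedIn (2 ^ m + c) (member B) → Balanced m (fold m (member B)) → InH M B
clear-upper-half m _ lower zero _ B s b =
  lower B s₀ (Balanced-cong m (fold-supported m s₀) b)
  where
  s₀ : SupportedIn (2 ^ m) (member B)
  s₀ = subst (λ N → SupportedIn N (member B)) (+-identityʳ (2 ^ m)) s
clear-upper-half zero    _ _ (suc c) ()
clear-upper-half {M} m@(suc _) m<M lower (suc c) c≤ B s b = by-top (member B (suc (2 ^ m + c))) refl
  where
  shift : ∀ {P : ℕ → Bool} → SupportedIn (2 ^ m + suc c) P → SupportedIn (suc (2 ^ m + c)) P
  shift {P} = subst (λ N → SupportedIn N P) (+-suc (2 ^ m) c)
  g : Subset (2 ^ M)
  g = gen M (suc m) (suc c)
  pair-top : pair (suc m) (suc c) (suc (2 ^ m + c)) ≡ true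
  pair-top rewrite sym (+-suc (2 ^ m) c) | ≡ᵇ-refl (2 ^ m + suc c) = ∨-zeroʳ _
  c< : suc c < 2 ^ m
  c< = m≤pred[n]⇒suc[m]≤n {{m^n≢0 2 m}} c≤
  by-top : ∀ t → member B (suc (2 ^ m + c)) ≡ t → InH M B
  by-top false top =
    clear-upper-half m m<M lower c (≤-trans (n≤1+n c) c≤) B (SupportedIn-pred (shift s) top) b
  by-top true  top = subst (InH M) (Δ-cancelˡ g B)
    (H-step (suc m) (suc c) (s≤s (s≤s z≤n)) m<M (s≤s z≤n) c≤
      (clear-upper-half m m<M lower c (≤-trans (n≤1+n c) c≤) (g Δ B)
        (SupportedIn-member (g Δ B) (member-gen-Δ M (suc m) (suc c) B)
          (SupportedIn-xor-pred (shift (pair-supported m (suc c))) (shift s) (trans pair-top (sym top))))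
        (Balanced-cong m (λ k 1≤k k≤ → sym (fold-gen-Δ m m<M (s≤s z≤n) c< B k 1≤k k≤)) b)))

Balanced⇒InH : ∀ {M} m → m ≤ M → (B : Subset (2 ^ M)) →
               SupportedIn (2 ^ m) (member B) → Balanced m (member B) → InH M B
Balanced⇒InH {M} zero _ B s b = subst (InH M) (sym (SupportedIn-0 B (SupportedIn-pred s b))) H-empty
Balanced⇒InH {M} (suc m) m<M B s (top , b) =
  clear-upper-half m m<M (Balanced⇒InH m (<⇒≤ m<M)) (2 ^ m ∸ 1) ≤-refl B
    (SupportedIn-pred (subst (λ N → SupportedIn N (member B)) 2^suc≡ s)
                      (subst (λ x → member B x ≡ false) 2^suc≡ top))
    b
  where
  2^suc≡ : 2 ^ suc m ≡ suc (2 ^ m + (2 ^ m ∸ 1))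
  2^suc≡ = trans (2^-double m)
             (trans (cong (2 ^ m +_) (sym (suc-pred (2 ^ m) {{m^n≢0 2 m}}))) (+-suc (2 ^ m) _))

-- Windows

-- window m r: the k ∈ {1,…,2^m} with k ≤ r < 2^m + k, i.e. those met an odd number
-- of times in the first r terms of S.
window : ℕ → ℕ → ℕ → Bool
window m r k = (k ≤ᵇ r) xor (2 ^ m + k ≤ᵇ r)

windowSet : ∀ m → ℕ → Subset (2 ^ m)
windowSet m r = fromPred (window m r)

member-windowSet-Δ : ∀ m r r' → AgreeOn (2 ^ m) (member (windowSet m r Δ windowSet m r'))
                                             (λ k → window m r k xor window m r' k)
member-windowSet-Δ m r r' k 1≤k k≤ = trans (member-Δ (windowSet m r) (windowSet m r') k)
  (cong₂ _xor_ (member-fromPred (window m r) k 1≤k k≤) (member-fromPred (window m r') k 1≤k k≤))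

window-full : ∀ m → AgreeOn (2 ^ m) (window m (2 ^ suc m)) (λ _ → false)
window-full m k _ k≤ rewrite ≤ᵇ-true (lower-half m k≤) | ≤ᵇ-true (upper-half m k≤) = refl

windowSet-full : ∀ m → windowSet m (2 ^ suc m) ≡ ∅
windowSet-full m = member-ext (windowSet m (2 ^ suc m)) ∅ λ k 1≤k k≤ →
  trans (member-fromPred (window m (2 ^ suc m)) k 1≤k k≤)
    (trans (window-full m k 1≤k k≤) (sym (member-∅ {2 ^ m} k)))

data Halves (n : ℕ) : ℕ → Set where
  lower : ∀ {r} → r < n → Halves n r
  upper : ∀ {s} → s < n → Halves n (n + s)

halves : ∀ n {r} → r < n + n → Halves n r
halves n {r} r< with r <? n
... | yes r<n = lower r<n
... | no  r≮n = subst (Halves n) (m+[n∸m]≡n n≤r)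
                  (upper (+-cancelˡ-< n (r ∸ n) n (subst (_< n + n) (sym (m+[n∸m]≡n n≤r)) r<)))
  where
  n≤r : n ≤ r
  n≤r = ≮⇒≥ r≮n

Halves-bound : ∀ {n r} → Halves n r → r < n + n
Halves-bound {n} (lower r<n) = <-≤-trans r<n (m≤m+n n n)
Halves-bound {n} (upper s<n) = +-monoʳ-< n s<n

residue : ∀ {n r} → Halves n r → ℕ
residue (lower {r} _) = r
residue (upper {s} _) = s

residue< : ∀ {n r} (v : Halves n r) → residue v < n
residue< (lower r<n) = r<n
residue< (upper s<n) = s<n

isUpper : ∀ {n r} → Halves n r → Bool
isUpper (lower _) = false
isUpper (upper _) = true

Halves-injective : ∀ {n r r'} (v : Halves n r) (v' : Halves n r') →
                   isUpper v ≡ isUpper v' → residue v ≡ residue v' → r ≡ r'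
Halves-injective (lower _) (lower _) _ refl = refl
Halves-injective (upper _) (upper _) _ refl = refl

window-top : ∀ m {r} (v : Halves (2 ^ suc m) r) → window (suc m) r (2 ^ suc m) ≡ isUpper v
window-top m (lower r<N)
  rewrite ≤ᵇ-false r<N | ≤ᵇ-false (<-≤-trans r<N (m≤m+n (2 ^ suc m) (2 ^ suc m))) = refl
window-top m (upper {s} s<N)
  rewrite ≤ᵇ-true (m≤m+n (2 ^ suc m) s) | +-cancelˡ-≤ᵇ (2 ^ suc m) (2 ^ suc m) s
        | ≤ᵇ-false s<N = refl

fold-window : ∀ m {r} (v : Halves (2 ^ suc m) r) →
              AgreeOn (2 ^ m) (fold m (window (suc m) r)) (window m (residue v))
fold-window m {r} (lower r<N) k _ k≤
  rewrite ≤ᵇ-false (<-≤-trans r<N (m≤m+n (2 ^ suc m) k))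
        | ≤ᵇ-false (<-≤-trans r<N (m≤m+n (2 ^ suc m) (2 ^ m + k)))
  = cong₂ _xor_ (xor-identityʳ (k ≤ᵇ r)) (xor-identityʳ (2 ^ m + k ≤ᵇ r))
fold-window m (upper {s} s<N) k _ k≤
  rewrite ≤ᵇ-true (≤-trans (lower-half m k≤) (m≤m+n (2 ^ suc m) s))
        | ≤ᵇ-true (≤-trans (upper-half m k≤) (m≤m+n (2 ^ suc m) s))
        | +-cancelˡ-≤ᵇ (2 ^ suc m) k s
        | +-cancelˡ-≤ᵇ (2 ^ suc m) (2 ^ m + k) s
  = xor-annihilates-not (k ≤ᵇ s) (2 ^ m + k ≤ᵇ s)

window-injective : ∀ m {r r'} → r < 2 ^ suc m → r' < 2 ^ suc m →
                   Balanced m (λ k → window m r k xor window m r' k) → r ≡ r'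
window-injective zero {0}           {0}           _            _            _  = refl
window-injective zero {1}           {1}           _            _            _  = refl
window-injective zero {0}           {1}           _            _            ()
window-injective zero {1}           {0}           _            _            ()
window-injective zero {suc (suc _)} {_}           (s≤s (s≤s ())) _          _
window-injective zero {_}           {suc (suc _)} _            (s≤s (s≤s ())) _
window-injective (suc m) {r} {r'} r< r'< (top , b) =
  Halves-injective v v'
    (xor≡false⇒≡ (trans (sym (cong₂ _xor_ (window-top m v) (window-top m v'))) top))
    (window-injective m (residue< v) (residue< v') (Balanced-cong m folded b))
  where
  v : Halves (2 ^ suc m) r
  v = halves (2 ^ suc m) (subst (r <_) (2^-double (suc m)) r<)
  v' : Halves (2 ^ suc m) r'
  v' = halves (2 ^ suc m) (subst (r' <_) (2^-double (suc m)) r'<)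
  folded : AgreeOn (2 ^ m) (fold m (λ k → window (suc m) r k xor window (suc m) r' k))
                           (λ k → window m (residue v) k xor window m (residue v') k)
  folded k 1≤k k≤ = trans (fold-xor m (window (suc m) r) (window (suc m) r') k)
                      (cong₂ _xor_ (fold-window m v k 1≤k k≤) (fold-window m v' k 1≤k k≤))

window-balancing : ∀ m (P : ℕ → Bool) →
                   ∃[ r ] (r < 2 ^ suc m × Balanced m (λ k → P k xor window m r k))
window-balancing zero P with P 1
... | false = 0 , s≤s z≤n , refl
... | true  = 1 , s≤s (s≤s z≤n) , refl
window-balancing (suc m) P with window-balancing m (fold m P)
... | s , s< , b = choose (P (2 ^ suc m)) refl
  where
  Goal : Set
  Goal = ∃[ r ] (r < 2 ^ suc (suc m) × Balanced (suc m) (λ k → P k xor window (suc m) r k))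
  extend : ∀ {r} (v : Halves (2 ^ suc m) r) → residue v ≡ s → P (2 ^ suc m) ≡ isUpper v → Goal
  extend {r} v refl top = r , subst (r <_) (sym (2^-double (suc m))) (Halves-bound v) ,
    trans (cong₂ _xor_ top (window-top m v)) (xor-same (isUpper v)) ,
    Balanced-cong m (λ k 1≤k k≤ → sym (trans (fold-xor m P (window (suc m) r) k)
                                        (cong (fold m P k xor_) (fold-window m v k 1≤k k≤)))) b
  choose : ∀ t → P (2 ^ suc m) ≡ t → Goal
  choose false top = extend (lower s<) refl top
  choose true  top = extend (upper s<) refl top

parity : ∀ {n} → ℕ → List (Fin n) → Bool
parity k []       = false
parity k (s ∷ ss) = (k ≡ᵇ suc (toℕ s)) xor parity k ss

member-walkEnd : ∀ {n} (U : Subset n) ss k → member (walkEnd U ss) k ≡ (member U k xor parity k ss)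
member-walkEnd U []       k = sym (xor-identityʳ (member U k))
member-walkEnd U (s ∷ ss) k = begin
  member (walkEnd (U Δ ⁅ s ⁆) ss) k
    ≡⟨ member-walkEnd (U Δ ⁅ s ⁆) ss k ⟩
  member (U Δ ⁅ s ⁆) k xor parity k ss
    ≡⟨ cong (_xor parity k ss)
         (trans (member-Δ U ⁅ s ⁆ k) (cong (member U k xor_) (member-⁅⁆ s k))) ⟩
  (member U k xor (k ≡ᵇ suc (toℕ s))) xor parity k ss
    ≡⟨ xor-assoc (member U k) _ (parity k ss) ⟩
  member U k xor parity k (s ∷ ss) ∎
  where open ≡-Reasoning

parity-++ : ∀ {n} k (xs ys : List (Fin n)) → parity k (xs ++ ys) ≡ (parity k xs xor parity k ys)
parity-++ k []       ys = refl
parity-++ k (x ∷ xs) ys =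
  trans (cong (b xor_) (parity-++ k xs ys)) (sym (xor-assoc b (parity k xs) (parity k ys)))
  where b = k ≡ᵇ suc (toℕ x)

parity-map-fsuc-1 : ∀ {n} (xs : List (Fin n)) → parity 1 (map fsuc xs) ≡ false
parity-map-fsuc-1 []       = refl
parity-map-fsuc-1 (x ∷ xs) = parity-map-fsuc-1 xs

parity-map-fsuc : ∀ {n} k (xs : List (Fin n)) → parity (suc (suc k)) (map fsuc xs) ≡ parity (suc k) xs
parity-map-fsuc k []       = refl
parity-map-fsuc k (x ∷ xs) = cong ((suc k ≡ᵇ suc (toℕ x)) xor_) (parity-map-fsuc k xs)

tabulate-fsuc : ∀ {n} r → take r (tabulate fsuc) ≡ map fsuc (take r (allFin n))
tabulate-fsuc {n} r = trans (cong (take r) (sym (map-tabulate (λ x → x) fsuc))) (take-map r (allFin n))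

parity-take-allFin : ∀ n k r → 1 ≤ k → k ≤ n → parity k (take r (allFin n)) ≡ (k ≤ᵇ r)
parity-take-allFin n       (suc k)       zero    _ _ = refl
parity-take-allFin (suc n) (suc zero)    (suc r) _ _ =
  cong (true xor_) (trans (cong (parity 1) (tabulate-fsuc r)) (parity-map-fsuc-1 (take r (allFin n))))
parity-take-allFin (suc n) (suc (suc k)) (suc r) _ (s≤s k≤n) = begin
  parity (suc (suc k)) (take r (tabulate fsuc))
    ≡⟨ cong (parity (suc (suc k))) (tabulate-fsuc r) ⟩
  parity (suc (suc k)) (map fsuc (take r (allFin n)))
    ≡⟨ parity-map-fsuc k (take r (allFin n)) ⟩
  parity (suc k) (take r (allFin n))
    ≡⟨ parity-take-allFin n (suc k) r (s≤s z≤n) k≤n ⟩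
  (suc k ≤ᵇ r)
    ≡⟨ suc-≤ᵇ-suc (suc k) r ⟨
  (suc (suc k) ≤ᵇ suc r) ∎
  where open ≡-Reasoning

length-allFin : ∀ n → length (allFin n) ≡ n
length-allFin n = length-tabulate {n = n} (λ x → x)

take-++ : ∀ {A : Set} r (xs ys : List A) → take r (xs ++ ys) ≡ take r xs ++ take (r ∸ length xs) ys
take-++ zero    []       ys = refl
take-++ zero    (x ∷ xs) ys = refl
take-++ (suc r) []       ys = refl
take-++ (suc r) (x ∷ xs) ys = cong (x ∷_) (take-++ r xs ys)

parity-take-seqS : ∀ m k r → 1 ≤ k → k ≤ 2 ^ m → parity k (take r (seqS m)) ≡ window m r k
parity-take-seqS m k r 1≤k k≤ = begin
  parity k (take r (xs ++ xs))
    ≡⟨ cong (parity k) (take-++ r xs xs) ⟩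
  parity k (take r xs ++ take (r ∸ length xs) xs)
    ≡⟨ parity-++ k (take r xs) _ ⟩
  parity k (take r xs) xor parity k (take (r ∸ length xs) xs)
    ≡⟨ cong (λ l → parity k (take r xs) xor parity k (take (r ∸ l) xs)) (length-allFin (2 ^ m)) ⟩
  parity k (take r xs) xor parity k (take (r ∸ 2 ^ m) xs)
    ≡⟨ cong₂ _xor_ (parity-take-allFin (2 ^ m) k r 1≤k k≤)
                   (parity-take-allFin (2 ^ m) k (r ∸ 2 ^ m) 1≤k k≤) ⟩
  (k ≤ᵇ r) xor (k ≤ᵇ r ∸ 2 ^ m)
    ≡⟨ cong ((k ≤ᵇ r) xor_) (≤ᵇ-∸ (2 ^ m) k r 1≤k) ⟩
  window m r k ∎
  where
  open ≡-Reasoning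
  xs : List (Fin (2 ^ m))
  xs = allFin (2 ^ m)

walkEnd-take-seqS : ∀ m (A : Subset (2 ^ m)) r → walkEnd A (take r (seqS m)) ≡ A Δ windowSet m r
walkEnd-take-seqS m A r = member-ext (walkEnd A (take r (seqS m))) (A Δ windowSet m r) λ k 1≤k k≤ →
  begin
  member (walkEnd A (take r (seqS m))) k
    ≡⟨ member-walkEnd A (take r (seqS m)) k ⟩
  member A k xor parity k (take r (seqS m))
    ≡⟨ cong (member A k xor_) (parity-take-seqS m k r 1≤k k≤) ⟩
  member A k xor window m r k
    ≡⟨ cong (member A k xor_) (member-fromPred {2 ^ m} (window m r) k 1≤k k≤) ⟨
  member A k xor member (windowSet m r) k
    ≡⟨ member-Δ A (windowSet m r) k ⟨
  member (A Δ windowSet m r) k ∎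
  where open ≡-Reasoning

length-seqS : ∀ m → length (seqS m) ≡ 2 ^ suc m
length-seqS m = begin
  length (allFin (2 ^ m) ++ allFin (2 ^ m))
    ≡⟨ length-++ (allFin (2 ^ m)) ⟩
  length (allFin (2 ^ m)) + length (allFin (2 ^ m))
    ≡⟨ cong₂ _+_ (length-allFin (2 ^ m)) (length-allFin (2 ^ m)) ⟩
  2 ^ m + 2 ^ m
    ≡⟨ 2^-double m ⟨
  2 ^ suc m ∎
  where open ≡-Reasoning

walkVertices-applyUpTo : ∀ {n} (U : Subset n) ss →
  walkVertices U ss ≡ applyUpTo (λ r → walkEnd U (take r ss)) (length ss)
walkVertices-applyUpTo U []       = refl
walkVertices-applyUpTo U (s ∷ ss) = cong (U ∷_) (walkVertices-applyUpTo (U Δ ⁅ s ⁆) ss)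

walkEdges-applyUpTo : ∀ {n} (U : Subset n) ss →
  walkEdges U ss ≡ applyUpTo (λ r → walkEnd U (take r ss) , walkEnd U (take (suc r) ss)) (length ss)
walkEdges-applyUpTo U []       = refl
walkEdges-applyUpTo U (s ∷ ss) = cong ((U , U Δ ⁅ s ⁆) ∷_) (walkEdges-applyUpTo (U Δ ⁅ s ⁆) ss)

-- The cycles C(A, S) for A in a coset of H

prevMod : ℕ → ℕ → ℕ
prevMod N zero    = N ∸ 1
prevMod N (suc q) = q

prevMod²≢ : ∀ {N} r → 2 < N → prevMod N (prevMod N r) ≢ r
prevMod²≢ zero          (s≤s (s≤s (s≤s _))) ()
prevMod²≢ (suc zero)    (s≤s (s≤s (s≤s _))) ()
prevMod²≢ (suc (suc q)) _ e = <⇒≢ (≤-trans (n<1+n q) (n≤1+n (suc q))) e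

module Cycles (m i : ℕ) where

  L : ℕ
  L = 2 ^ suc m

  U₀ : Subset (2 ^ m)
  U₀ = upToSet (2 * i ∸ 2)

  vertex : Subset (2 ^ m) → ℕ → Subset (2 ^ m)
  vertex A r = walkEnd A (take r (seqS m))

  vertex-L : ∀ A → vertex A L ≡ A
  vertex-L A =
    trans (walkEnd-take-seqS m A L) (trans (cong (A Δ_) (windowSet-full m)) (Δ-identityʳ A))

  vertex-injective : ∀ {A A' r r'} → InHi m i A → InHi m i A' → r < L → r' < L →
                     vertex A r ≡ vertex A' r' → A ≡ A' × r ≡ r'
  vertex-injective {r = r} {r'} (B , hB , refl) (B' , hB' , refl) r< r'< e = A≡A' , r≡r'
    where
    e' : (U₀ Δ B) Δ windowSet m r ≡ (U₀ Δ B') Δ windowSet m r'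
    e' = trans (sym (walkEnd-take-seqS m (U₀ Δ B) r)) (trans e (walkEnd-take-seqS m (U₀ Δ B') r'))
    B-diff : B Δ B' ≡ windowSet m r Δ windowSet m r'
    B-diff = begin
      B Δ B'                         ≡⟨ Δ-identityˡ (B Δ B') ⟨
      ∅ Δ (B Δ B')                   ≡⟨ cong (_Δ (B Δ B')) (Δ-self U₀) ⟨
      (U₀ Δ U₀) Δ (B Δ B')           ≡⟨ Δ-interchange U₀ B U₀ B' ⟨
      (U₀ Δ B) Δ (U₀ Δ B')           ≡⟨ Δ-transpose e' ⟩
      windowSet m r Δ windowSet m r' ∎
      where open ≡-Reasoning
    r≡r' : r ≡ r'
    r≡r' = window-injective m r< r'< (Balanced-cong m (member-windowSet-Δ m r r')
             (InH⇒Balanced (subst (InH m) B-diff (InH-Δ hB hB'))))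
    A≡A' : U₀ Δ B ≡ U₀ Δ B'
    A≡A' = Δ-cancelʳ-≡
      (subst (λ t → (U₀ Δ B) Δ windowSet m r ≡ (U₀ Δ B') Δ windowSet m t) (sym r≡r') e')

  vertex-surjective : ∀ V → ∃[ A ] ∃[ r ] (InHi m i A × r < L × V ≡ vertex A r)
  vertex-surjective V with window-balancing m (member (U₀ Δ V))
  ... | r , r< , b = U₀ Δ B , r , (B , InH-B , refl) , r< , sym V≡
    where
    W : Subset (2 ^ m)
    W = windowSet m r
    B : Subset (2 ^ m)
    B = (U₀ Δ V) Δ W
    InH-B : InH m B
    InH-B = Balanced⇒InH m ≤-refl B (member-supported B) (Balanced-cong m agree b)
      where
      agree : AgreeOn (2 ^ m) (λ k → member (U₀ Δ V) k xor window m r k) (member B)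
      agree k 1≤k k≤ = sym (trans (member-Δ (U₀ Δ V) W k)
                              (cong (member (U₀ Δ V) k xor_) (member-fromPred (window m r) k 1≤k k≤)))
    V≡ : vertex (U₀ Δ B) r ≡ V
    V≡ = begin
      vertex (U₀ Δ B) r           ≡⟨ walkEnd-take-seqS m (U₀ Δ B) r ⟩
      (U₀ Δ ((U₀ Δ V) Δ W)) Δ W   ≡⟨ cong (_Δ W) (Δ-assoc U₀ (U₀ Δ V) W) ⟨
      ((U₀ Δ (U₀ Δ V)) Δ W) Δ W   ≡⟨ Δ-cancelʳ (U₀ Δ (U₀ Δ V)) W ⟩
      U₀ Δ (U₀ Δ V)               ≡⟨ Δ-cancelˡ U₀ V ⟩
      V                           ∎
      where open ≡-Reasoning

  walkVertices-seqS : ∀ A → walkVertices A (seqS m) ≡ applyUpTo (vertex A) L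
  walkVertices-seqS A =
    trans (walkVertices-applyUpTo A (seqS m)) (cong (applyUpTo (vertex A)) (length-seqS m))

  walkEdges-seqS : ∀ A → walkEdges A (seqS m) ≡ applyUpTo (λ q → vertex A q , vertex A (suc q)) L
  walkEdges-seqS A = trans (walkEdges-applyUpTo A (seqS m))
    (cong (applyUpTo (λ q → vertex A q , vertex A (suc q))) (length-seqS m))

  ∈-walkVertices⁺ : ∀ {A r} → r < L → vertex A r ∈ walkVertices A (seqS m)
  ∈-walkVertices⁺ {A} {r} r< =
    subst (vertex A r ∈_) (sym (walkVertices-seqS A)) (∈-applyUpTo⁺ (vertex A) r<)

  ∈-walkVertices⁻ : ∀ {A V} → V ∈ walkVertices A (seqS m) → ∃[ r ] (r < L × V ≡ vertex A r)
  ∈-walkVertices⁻ {A} p = ∈-applyUpTo⁻ (vertex A) (subst (_ ∈_) (walkVertices-seqS A) p)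

  ∈-walkEdges⁺ : ∀ {A q} → q < L → (vertex A q , vertex A (suc q)) ∈ walkEdges A (seqS m)
  ∈-walkEdges⁺ {A} {q} q< = subst ((vertex A q , vertex A (suc q)) ∈_) (sym (walkEdges-seqS A))
    (∈-applyUpTo⁺ (λ q → vertex A q , vertex A (suc q)) q<)

  ∈-walkEdges⁻ : ∀ {A V W} → (V , W) ∈ walkEdges A (seqS m) →
                 ∃[ q ] (q < L × V ≡ vertex A q × W ≡ vertex A (suc q))
  ∈-walkEdges⁻ {A} p with ∈-applyUpTo⁻ _ (subst (_ ∈_) (walkEdges-seqS A) p)
  ... | q , q< , e = q , q< , cong proj₁ e , cong proj₂ e

  prev : ℕ → ℕ
  prev = prevMod L

  suc[L-1]≡L : suc (L ∸ 1) ≡ L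
  suc[L-1]≡L = suc-pred L {{m^n≢0 2 (suc m)}}

  edge-from-prev : ∀ {A r} → r < L → prev r < L × vertex A (suc (prev r)) ≡ vertex A r
  edge-from-prev {A} {zero}  _  =
    ≤-reflexive suc[L-1]≡L , trans (cong (vertex A) suc[L-1]≡L) (vertex-L A)
  edge-from-prev {A} {suc q} r< = <-trans (n<1+n q) r< , refl

  edge-into : ∀ {A q} → q < L → ∃[ r ] (r < L × vertex A (suc q) ≡ vertex A r × prev r ≡ q)
  edge-into {A} {q} q< with m≤n⇒m<n∨m≡n q<
  ... | inj₁ q+1<L = suc q , q+1<L , refl , refl
  ... | inj₂ q+1≡L = 0 , 2^>0 (suc m) , trans (cong (vertex A) q+1≡L) (vertex-L A) ,
                       cong (_∸ 1) (sym q+1≡L)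

  is-cycle : ∀ A → InHi m i A → IsCycleOfLength (2 * 2 ^ m) A (seqS m)
  is-cycle A hA =
    trans (cong (walkEnd A) (sym (take-all L (seqS m) (≤-reflexive (length-seqS m))))) (vertex-L A) ,
    trans (cong length (walkVertices-seqS A)) (length-applyUpTo (vertex A) L) ,
    subst Unique (sym (walkVertices-seqS A)) (applyUpTo⁺₁ (vertex A) L λ q<r r<L e →
      <⇒≢ q<r (proj₂ (vertex-injective hA hA (<-trans q<r r<L) r<L e)))

  disjoint : ∀ A B → InHi m i A → InHi m i B → A ≢ B →
             ∀ V → V ∈ walkVertices A (seqS m) → V ∈ walkVertices B (seqS m) → ⊥
  disjoint A B hA hB A≢B V VA VB with ∈-walkVertices⁻ VA | ∈-walkVertices⁻ VB
  ... | r , r< , eA | r' , r'< , eB = A≢B (proj₁ (vertex-injective hA hB r< r'< (trans (sym eA) eB)))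

  spanning : UnionSpanning m i
  spanning V with vertex-surjective V
  ... | A , r , hA , r< , V≡ =
    A , hA , subst (_∈ walkVertices A (seqS m)) (sym V≡) (∈-walkVertices⁺ r<)

  two-regular : 1 ≤ m → UnionTwoRegular m i
  two-regular 1≤m V with vertex-surjective V
  ... | A , r , hA , r< , refl = vertex A (suc r) , vertex A (prev r) , next≢prev ,
          (A , hA , inj₁ (∈-walkEdges⁺ r<)) ,
          (A , hA , inj₂ (subst (λ X → (vertex A (prev r) , X) ∈ walkEdges A (seqS m))
                              (proj₂ prev-edge) (∈-walkEdges⁺ (proj₁ prev-edge)))) ,
          only
    where
    prev-edge : prev r < L × vertex A (suc (prev r)) ≡ vertex A r
    prev-edge = edge-from-prev r<
    next≢prev : vertex A (suc r) ≢ vertex A (prev r)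
    next≢prev e with edge-into {A} r<
    ... | r₁ , r₁< , next≡ , prev-r₁ =
      prevMod²≢ r (≤-trans (n≤1+n 3) (^-monoʳ-≤ 2 (s≤s 1≤m)))
        (trans (cong prev (sym (proj₂ (vertex-injective hA hA r₁< (proj₁ prev-edge)
          (trans (sym next≡) e))))) prev-r₁)
    only : ∀ W → UnionEdge m i (vertex A r) W → W ≡ vertex A (suc r) ⊎ W ≡ vertex A (prev r)
    only W (A' , hA' , inj₁ p) with ∈-walkEdges⁻ p
    ... | q , q< , V≡ , W≡ with vertex-injective hA hA' r< q< V≡
    ...   | refl , refl = inj₁ W≡
    only W (A' , hA' , inj₂ p) with ∈-walkEdges⁻ p
    ... | q , q< , W≡ , V≡ with edge-into {A'} q<
    ...   | r₁ , r₁< , next≡ , prev-r₁ with vertex-injective hA hA' r< r₁< (trans V≡ next≡)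
    ...     | refl , refl = inj₂ (trans W≡ (cong (vertex A) (sym prev-r₁)))

lemma2p4 : (m : ℕ) → 2 ≤ m → (i : ℕ) → 1 ≤ i → i ≤ 2 ^ m / 2 →
    (∀ A → InHi m i A → IsCycleOfLength (2 * 2 ^ m) A (seqS m)) ×
    (∀ A B → InHi m i A → InHi m i B → A ≢ B →
      ∀ V → V ∈ walkVertices A (seqS m) → V ∈ walkVertices B (seqS m) → ⊥) ×
    UnionSpanning m i × UnionTwoRegular m i
lemma2p4 m 2≤m i _ _ = is-cycle , disjoint , spanning , two-regular (≤-trans (s≤s z≤n) 2≤m)
  where open Cycles m i
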